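{- The weighted generating function of closed polygons in the $n$-th Schreier graph $\Sigma_n$ of the Basilica group is $$\Gamma^{cl}_n(a,b)=\prod_{k=1}^{\frac{n-1}{2}-1}\left(1+a^{2^k}\right)^{2^{n-2k-1}}\prod_{k=1}^{\frac{n-1}{2}-1}\left(1+b^{2^k}\right)^{2^{n-2k}}\left(1+a^{2^{\frac{n-1}{2}}}\right)^2\left(1+b^{2^{\frac{n-1}{2}}}\right)^2\left(1+b^{2^{\frac{n+1}{2}}}\right)$$ for $n\geq5$ odd, and $$\Gamma^{cl}_n(a,b)=\prod_{k=1}^{\frac n2-1}\left(1+a^{2^k}\right)^{2^{n-2k-1}}\prod_{k=1}^{\frac n2-1}\left(1+b^{2^k}\right)^{2^{n-2k}}\left(1+a^{2^{\frac n2}}\right)\left(1+b^{2^{\frac n2}}\right)^2$$ for $n\geq4$ even.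
   Context: Automorphisms of the rooted binary tree (vertices = finite words over $\{0,1\}$) are written $g=\tau(g_0,g_1)$, meaning $g(xw)=\tau(x)g_x(w)$. The Basilica group is generated by $a$ and $b$ with $a(0w)=0b(w)$, $a(1w)=1w$, $b(0w)=1a(w)$, $b(1w)=0w$. Its $n$-th Schreier graph $\Sigma_n$ has vertex set the $2^n$ words of length $n$; for each $s\in\{a,b\}$ and each vertex $u$ with $s(u)\neq u$ there is one edge joining $u$ and $s(u)$, labeled $s$ (double edges may occur); loops are erased. A closed polygon is a subset of the edge set in which every vertex has even degree (empty set included). The weighted generating function is $\Gamma^{cl}_n(a,b)=\sum_X a^{\#\{a\text{ -edges in }X\}}b^{\#\{b\text{ -edges in }X\}}$, the sum over closed polygons $X$ of $\Sigma_n$. -}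

module Defs where

open import Level using (Level)
open import Data.Bool using (Bool; true; false; _∧_; if_then_else_; not)
open import Data.Nat using (ℕ; zero; suc; _∸_; _^_)
open import Data.Vec using (Vec; []; _∷_)
open import Data.Vec.Properties using (≡-dec)
import Data.Bool.Properties as BoolP
open import Data.List using (List; []; _∷_; [_]; _++_; map; filter; length; concatMap; foldr)
open import Data.Product using (_×_; _,_; proj₁; proj₂)
open import Relation.Nullary using (Dec; yes; no; ¬?; _⊎-dec_)
open import Relation.Binary.PropositionalEquality using (_≡_; refl)
open import Algebra.Bundles using (CommutativeSemiring)

data Gen : Set where
  ga gb : Gen

_≟G_ : (s t : Gen) → Dec (s ≡ t)
ga ≟G ga = yes refl
ga ≟G gb = no (λ ())
gb ≟G ga = no (λ ())
gb ≟G gb = yes refl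

-- Letters: false = 0, true = 1.  Words of length n = Vec Bool n.
-- a(0w) = 0 b(w), a(1w) = 1w, b(0w) = 1 a(w), b(1w) = 0w.
act : {n : ℕ} → Gen → Vec Bool n → Vec Bool n
act s [] = []
act ga (false ∷ w) = false ∷ act gb w
act ga (true ∷ w) = true ∷ w
act gb (false ∷ w) = true ∷ act ga w
act gb (true ∷ w) = false ∷ w

_≟W_ : {n : ℕ} → (u v : Vec Bool n) → Dec (u ≡ v)
_≟W_ = ≡-dec BoolP._≟_

words : (n : ℕ) → List (Vec Bool n)
words zero = [ [] ]
words (suc n) = map (false ∷_) (words n) ++ map (true ∷_) (words n)

-- An edge of Σ_n: a pair (s , u) with s(u) ≠ u, joining u and s(u), labeled s.
Edge : ℕ → Set
Edge n = Gen × Vec Bool n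

edges : (n : ℕ) → List (Edge n)
edges n = filter (λ e → ¬? (act (proj₁ e) (proj₂ e) ≟W proj₂ e))
                 (concatMap (λ s → map (λ u → (s , u)) (words n)) (ga ∷ gb ∷ []))

sublists : {A : Set} → List A → List (List A)
sublists [] = [ [] ]
sublists (x ∷ xs) = sublists xs ++ map (x ∷_) (sublists xs)

-- degree of vertex v in an edge set X (endpoints of an edge are distinct)
degree : {n : ℕ} → Vec Bool n → List (Edge n) → ℕ
degree v X = length (filter (λ e → (v ≟W proj₂ e) ⊎-dec (v ≟W act (proj₁ e) (proj₂ e))) X)

isEven : ℕ → Bool
isEven zero = true
isEven (suc k) = not (isEven k)

isClosed : {n : ℕ} → List (Edge n) → Bool
isClosed {n} X = foldr _∧_ true (map (λ v → isEven (degree v X)) (words n))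

countLabel : {n : ℕ} → Gen → List (Edge n) → ℕ
countLabel s X = length (filter (λ e → proj₁ e ≟G s) X)

module _ {c ℓ : Level} (R : CommutativeSemiring c ℓ) where
  open CommutativeSemiring R

  pow : Carrier → ℕ → Carrier
  pow x zero = 1#
  pow x (suc k) = x * pow x k

  sumR : List Carrier → Carrier
  sumR = foldr _+_ 0#

  prodTo : ℕ → (ℕ → Carrier) → Carrier
  prodTo zero f = 1#
  prodTo (suc j) f = prodTo j f * f (suc j)

  Γcl : (n : ℕ) → Carrier → Carrier → Carrier
  Γcl n x y = sumR (map (λ X → if isClosed X
                                then pow x (countLabel ga X) * pow y (countLabel gb X)
                                else 0#)
                        (sublists (edges n)))

  -- right-hand side for n = 2m+1 odd ((n-1)/2 = m)
  rhsOdd : (n m : ℕ) → Carrier → Carrier → Carrier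
  rhsOdd n m x y =
    prodTo (m ∸ 1) (λ k → pow (1# + pow x (2 ^ k)) (2 ^ (n ∸ 2 Data.Nat.* k ∸ 1)))
    * prodTo (m ∸ 1) (λ k → pow (1# + pow y (2 ^ k)) (2 ^ (n ∸ 2 Data.Nat.* k)))
    * pow (1# + pow x (2 ^ m)) 2
    * pow (1# + pow y (2 ^ m)) 2
    * (1# + pow y (2 ^ suc m))

  -- right-hand side for n = 2m even (n/2 = m)
  rhsEven : (n m : ℕ) → Carrier → Carrier → Carrier
  rhsEven n m x y =
    prodTo (m ∸ 1) (λ k → pow (1# + pow x (2 ^ k)) (2 ^ (n ∸ 2 Data.Nat.* k ∸ 1)))
    * prodTo (m ∸ 1) (λ k → pow (1# + pow y (2 ^ k)) (2 ^ (n ∸ 2 Data.Nat.* k)))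
    * (1# + pow x (2 ^ m))
    * pow (1# + pow y (2 ^ m)) 2

EqR : {c ℓ : Level} (R : CommutativeSemiring c ℓ) →
      CommutativeSemiring.Carrier R → CommutativeSemiring.Carrier R → Set ℓ
EqR R = CommutativeSemiring._≈_ R

-- A closed polygon is an edge set with empty mod-2 boundary, so Γcl n is the value at the empty
-- boundary of a sum over edge sets refined by the boundary they leave. In Σ (n+1) every vertex
-- 1 a(w) has degree two, joined by b-edges to 0 w and to 0 a(w); summing out its two edges merges
-- them into one edge 0 w — 0 a(w) of weight y². That edge is a loop exactly when a fixes w, and a
-- loop only contributes a factor 1 + y². The remaining edges form a copy of Σ n on the words 0 w
-- in which the roles of a and b are exchanged, whence
--   Γcl (n+1) (x, y) = (1 + y²)^#Fix(a on words of length n) · Γcl n (y², x).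
-- For n ≥ 2, a fixes exactly the 2^(n-1) words starting with 1; applying the recursion twice, the
-- closed forms follow by induction from n = 2 and n = 3.
module Submission where

open import Defs
open import Level using (Level)
open import Algebra.Bundles using (CommutativeSemiring)
import Algebra.Properties.Semiring.Exp
open import Data.Bool using (Bool; true; false; not; _xor_; if_then_else_)
open import Data.Bool.ListAction using (and; all)
open import Data.Bool.Properties
  using (xor-assoc; xor-comm; xor-same; xor-identityʳ; true-xor; ∧-isCommutativeMonoid)
open import Data.Empty using (⊥-elim)
open import Data.List using (List; []; _∷_; _++_; map; filter; length; concatMap)
open import Data.List.Properties
  using (map-cong; map-∘; map-++; length-++; length-map; ++-identityʳ; filter-++; filter-all; filter-none)
open import Data.List.Membership.Propositional using (_∈_)
open import Data.List.Membership.Propositional.Properties using (∈-map⁻)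
open import Data.List.Relation.Unary.All as All using (All; []; _∷_; universal)
import Data.List.Relation.Unary.All.Properties as Allₚ
open import Data.List.Relation.Unary.AllPairs using ([]; _∷_)
open import Data.List.Relation.Unary.Unique.Propositional using (Unique)
import Data.List.Relation.Unary.Unique.Propositional.Properties as Unique
open import Data.List.Relation.Binary.Permutation.Propositional
  using (_↭_; prep; swap; ↭-sym; ↭⇒↭ₛ; module PermutationReasoning)
  renaming (refl to ↭-refl; trans to ↭-trans)
import Data.List.Relation.Binary.Permutation.Propositional.Properties as ↭
import Data.List.Relation.Binary.Permutation.Setoid.Properties as ↭ₛ
open import Data.Nat using (ℕ; zero; suc; _^_; _∸_)
import Data.Nat as ℕ
import Data.Nat.Properties as ℕ
open import Data.Product using (_×_; _,_; proj₁; proj₂)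
open import Data.Sum using (_⊎_)
open import Data.Vec using (Vec; []; _∷_; tail)
open import Function using (_∘_)
open import Function.Definitions using (Injective)
open import Relation.Binary.Definitions using (DecidableEquality)
open import Relation.Binary.PropositionalEquality using (_≡_; refl; cong; cong₂; _≗_)
import Relation.Binary.PropositionalEquality as ≡
import Relation.Binary.Reasoning.Setoid as SetoidReasoning
open import Relation.Nullary using (Dec; ¬_; ¬?; does; yes; no; _⊎-dec_)
open import Relation.Nullary.Decidable using (dec-true; dec-false)
open import Relation.Unary using (Pred; Decidable)

filter-map-comm : ∀ {a b p q} {A : Set a} {B : Set b} {P : Pred B p} {Q : Pred A q}
                  (P? : Decidable P) (Q? : Decidable Q) (f : A → B) →
                  (∀ a → does (P? (f a)) ≡ does (Q? a)) →
                  ∀ as → filter P? (map f as) ≡ map f (filter Q? as)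
filter-map-comm P? Q? f same []       = refl
filter-map-comm P? Q? f same (a ∷ as) rewrite same a with does (Q? a)
... | true  = cong (f a ∷_) (filter-map-comm P? Q? f same as)
... | false = filter-map-comm P? Q? f same as

map-∘₃ : ∀ {a b c d} {A : Set a} {B : Set b} {C : Set c} {D : Set d}
         (f : C → D) (g : B → C) (h : A → B) xs → map f (map g (map h xs)) ≡ map (f ∘ g ∘ h) xs
map-∘₃ f g h xs = ≡.sym (≡.trans (map-∘ xs) (cong (map f) (map-∘ xs)))

module EdgeSubsetSums {c ℓ : Level} (R : CommutativeSemiring c ℓ) where
  open CommutativeSemiring R renaming (refl to ≈-refl; sym to ≈-sym; trans to ≈-trans)
  open SetoidReasoning setoid
  open import Algebra.Solver.Ring.NaturalCoefficients.Default R

  record WeightedEdge (V : Set) : Set c where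
    constructor edge
    field
      src tgt : V
      weight  : Carrier

  open WeightedEdge public

  mapEdge : {V W : Set} → (V → W) → WeightedEdge V → WeightedEdge W
  mapEdge φ (edge s t w) = edge (φ s) (φ t) w

  module Joins {V : Set} (_≟_ : DecidableEquality V) where

    -- Taken mod 2, so it vanishes identically on a loop.
    boundary : WeightedEdge V → V → Bool
    boundary e v = does (v ≟ src e) xor does (v ≟ tgt e)

    _+∂_ : (V → Bool) → WeightedEdge V → V → Bool
    (T +∂ e) v = T v xor boundary e v

    vanishesOn : List V → (V → Bool) → Bool
    vanishesOn Vs T = all (not ∘ T) Vs

    -- joinSum Vs L T is the total weight of the subsets X of L whose boundary
    -- (the set of vertices of odd X-degree) agrees with T on Vs.
    joinSum : List V → List (WeightedEdge V) → (V → Bool) → Carrier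
    joinSum Vs []      T = if vanishesOn Vs T then 1# else 0#
    joinSum Vs (e ∷ L) T = joinSum Vs L T + weight e * joinSum Vs L (T +∂ e)

    loop? : Decidable (λ e → tgt e ≡ src e)
    loop? e = tgt e ≟ src e

    boundary-∉ : ∀ {z} e → ¬ z ≡ src e → ¬ z ≡ tgt e → boundary e z ≡ false
    boundary-∉ {z} e z≢s z≢t rewrite dec-false (z ≟ src e) z≢s | dec-false (z ≟ tgt e) z≢t = refl

    boundary-src : ∀ e → ¬ src e ≡ tgt e → boundary e (src e) ≡ true
    boundary-src e s≢t rewrite dec-true (src e ≟ src e) refl | dec-false (src e ≟ tgt e) s≢t = refl

    boundary-tgt : ∀ e → ¬ tgt e ≡ src e → boundary e (tgt e) ≡ true
    boundary-tgt e t≢s rewrite dec-false (tgt e ≟ src e) t≢s | dec-true (tgt e ≟ tgt e) refl = refl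

    boundary-loop : ∀ e → tgt e ≡ src e → ∀ v → boundary e v ≡ false
    boundary-loop e t≡s v rewrite t≡s = xor-same (does (v ≟ src e))

    boundary-path : ∀ u z t w₁ w₂ w v →
                    boundary (edge u z w₁) v xor boundary (edge z t w₂) v ≡ boundary (edge u t w) v
    boundary-path u z t w₁ w₂ w v =
      ≡.trans (xor-assoc atU atZ (atZ xor atT))
        (cong (atU xor_) (≡.trans (≡.sym (xor-assoc atZ atZ atT)) (cong (_xor atT) (xor-same atZ))))
      where
        atU = does (v ≟ u)
        atZ = does (v ≟ z)
        atT = does (v ≟ t)

    vanishesOn-cong : ∀ Vs {T T′} → T ≗ T′ → vanishesOn Vs T ≡ vanishesOn Vs T′
    vanishesOn-cong Vs T≗T′ = cong and (map-cong (cong not ∘ T≗T′) Vs)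

    vanishesOn-↭ : ∀ {Vs Us} → Vs ↭ Us → ∀ T → vanishesOn Vs T ≡ vanishesOn Us T
    vanishesOn-↭ π T =
      ↭ₛ.foldr-commMonoid (≡.setoid Bool) ∧-isCommutativeMonoid (↭⇒↭ₛ (↭.map⁺ (not ∘ T) π))

    joinSum-congᵗ : ∀ Vs L {T T′} → T ≗ T′ → joinSum Vs L T ≈ joinSum Vs L T′
    joinSum-congᵗ Vs []      T≗T′ rewrite vanishesOn-cong Vs T≗T′ = ≈-refl
    joinSum-congᵗ Vs (e ∷ L) T≗T′ =
      +-cong (joinSum-congᵗ Vs L T≗T′)
             (*-congˡ (joinSum-congᵗ Vs L (λ v → cong (_xor boundary e v) (T≗T′ v))))

    joinSum-↭ᵛ : ∀ {Vs Us} → Vs ↭ Us → ∀ L T → joinSum Vs L T ≈ joinSum Us L T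
    joinSum-↭ᵛ π []      T rewrite vanishesOn-↭ π T = ≈-refl
    joinSum-↭ᵛ π (e ∷ L) T = +-cong (joinSum-↭ᵛ π L T) (*-congˡ (joinSum-↭ᵛ π L _))

    joinSum-swap : ∀ Vs e f L T → joinSum Vs (e ∷ f ∷ L) T ≈ joinSum Vs (f ∷ e ∷ L) T
    joinSum-swap Vs e f L T =
      begin
        (J T + wf * J (T +∂ f)) + we * (J (T +∂ e) + wf * J ((T +∂ e) +∂ f))
      ≈⟨ +-congˡ (*-congˡ (+-congˡ (*-congˡ (joinSum-congᵗ Vs L boundaries-commute)))) ⟩
        (J T + wf * J (T +∂ f)) + we * (J (T +∂ e) + wf * J ((T +∂ f) +∂ e))
      ≈⟨ solve 6 (λ A B C D we wf → (A :+ wf :* B) :+ we :* (C :+ wf :* D)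
                                  := (A :+ we :* C) :+ wf :* (B :+ we :* D))
               ≈-refl (J T) (J (T +∂ f)) (J (T +∂ e)) (J ((T +∂ f) +∂ e)) we wf ⟩
        (J T + we * J (T +∂ e)) + wf * (J (T +∂ f) + we * J ((T +∂ f) +∂ e))
      ∎
      where
        J = joinSum Vs L
        we = weight e
        wf = weight f
        boundaries-commute : (T +∂ e) +∂ f ≗ (T +∂ f) +∂ e
        boundaries-commute v =
          ≡.trans (xor-assoc (T v) _ _)
            (≡.trans (cong (T v xor_) (xor-comm (boundary e v) _)) (≡.sym (xor-assoc (T v) _ _)))

    joinSum-↭ : ∀ Vs {L L′} → L ↭ L′ → ∀ T → joinSum Vs L T ≈ joinSum Vs L′ T
    joinSum-↭ Vs ↭-refl                  T = ≈-refl
    joinSum-↭ Vs (prep e π)              T = +-cong (joinSum-↭ Vs π T) (*-congˡ (joinSum-↭ Vs π _))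
    joinSum-↭ Vs {e ∷ f ∷ L} (swap e f π) T =
      ≈-trans (joinSum-swap Vs e f L T)
        (+-cong (+-cong (joinSum-↭ Vs π _) (*-congˡ (joinSum-↭ Vs π _)))
                (*-congˡ (+-cong (joinSum-↭ Vs π _) (*-congˡ (joinSum-↭ Vs π _)))))
    joinSum-↭ Vs (↭-trans π ρ)           T = ≈-trans (joinSum-↭ Vs π T) (joinSum-↭ Vs ρ T)

    joinSum-isolated-even : ∀ z Us L T → All (λ e → boundary e z ≡ false) L → T z ≡ false →
                            joinSum (z ∷ Us) L T ≈ joinSum Us L T
    joinSum-isolated-even z Us []      T []         Tz rewrite Tz = ≈-refl
    joinSum-isolated-even z Us (e ∷ L) T (∂z ∷ ∂zs) Tz =
      +-cong (joinSum-isolated-even z Us L T ∂zs Tz)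
             (*-congˡ (joinSum-isolated-even z Us L (T +∂ e) ∂zs (cong₂ _xor_ Tz ∂z)))

    joinSum-isolated-odd : ∀ z Us L T → All (λ e → boundary e z ≡ false) L → T z ≡ true →
                           joinSum (z ∷ Us) L T ≈ 0#
    joinSum-isolated-odd z Us []      T []         Tz rewrite Tz = ≈-refl
    joinSum-isolated-odd z Us (e ∷ L) T (∂z ∷ ∂zs) Tz =
      begin
        joinSum (z ∷ Us) L T + weight e * joinSum (z ∷ Us) L (T +∂ e)
      ≈⟨ +-cong (joinSum-isolated-odd z Us L T ∂zs Tz)
                (*-congˡ (joinSum-isolated-odd z Us L (T +∂ e) ∂zs (cong₂ _xor_ Tz ∂z))) ⟩
        0# + weight e * 0#
      ≈⟨ ≈-trans (+-identityˡ _) (zeroʳ _) ⟩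
        0#
      ∎

    joinSum-series : ∀ {u z t} w₁ w₂ Us L T → ¬ z ≡ u → ¬ z ≡ t →
                     All (λ e → boundary e z ≡ false) L → T z ≡ false →
                     joinSum (z ∷ Us) (edge u z w₁ ∷ edge z t w₂ ∷ L) T
                       ≈ joinSum Us (edge u t (w₁ * w₂) ∷ L) T
    joinSum-series {u} {z} {t} w₁ w₂ Us L T z≢u z≢t ∂zs Tz =
      begin
        (J T + w₂ * J T₂) + w₁ * (J T₁ + w₂ * J T₁₂)
      ≈⟨ +-cong (+-cong (even T Tz) (*-congˡ (odd T₂ T₂z)))
                (*-congˡ (+-cong (odd T₁ T₁z) (*-congˡ (even T₁₂ T₁₂z)))) ⟩
        (J′ T + w₂ * 0#) + w₁ * (0# + w₂ * J′ T₁₂)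
      ≈⟨ solve 4 (λ A D w₁ w₂ → (A :+ w₂ :* con 0) :+ w₁ :* (con 0 :+ w₂ :* D)
                              := A :+ (w₁ :* w₂) :* D)
               ≈-refl (J′ T) (J′ T₁₂) w₁ w₂ ⟩
        J′ T + (w₁ * w₂) * J′ T₁₂
      ≈⟨ +-congˡ (*-congˡ (joinSum-congᵗ Us L (λ v →
           ≡.trans (xor-assoc (T v) _ _) (cong (T v xor_) (boundary-path u z t w₁ w₂ (w₁ * w₂) v))))) ⟩
        J′ T + (w₁ * w₂) * J′ (T +∂ edge u t (w₁ * w₂))
      ∎
      where
        e₁ = edge u z w₁
        e₂ = edge z t w₂
        T₁ = T +∂ e₁
        T₂ = T +∂ e₂
        T₁₂ = T₁ +∂ e₂
        J = joinSum (z ∷ Us) L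
        J′ = joinSum Us L
        even : ∀ T′ → T′ z ≡ false → J T′ ≈ J′ T′
        even T′ = joinSum-isolated-even z Us L T′ ∂zs
        odd : ∀ T′ → T′ z ≡ true → J T′ ≈ 0#
        odd T′ = joinSum-isolated-odd z Us L T′ ∂zs
        T₁z : T₁ z ≡ true
        T₁z = cong₂ _xor_ Tz (boundary-tgt e₁ z≢u)
        T₂z : T₂ z ≡ true
        T₂z = cong₂ _xor_ Tz (boundary-src e₂ z≢t)
        T₁₂z : T₁₂ z ≡ false
        T₁₂z = cong₂ _xor_ T₁z (boundary-src e₂ z≢t)

    joinSum-loop : ∀ Vs e L T → tgt e ≡ src e → joinSum Vs (e ∷ L) T ≈ (1# + weight e) * joinSum Vs L T
    joinSum-loop Vs e L T t≡s =
      begin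
        joinSum Vs L T + weight e * joinSum Vs L (T +∂ e)
      ≈⟨ +-congˡ (*-congˡ (joinSum-congᵗ Vs L (λ v →
           ≡.trans (cong (T v xor_) (boundary-loop e t≡s v)) (xor-identityʳ (T v))))) ⟩
        joinSum Vs L T + weight e * joinSum Vs L T
      ≈⟨ solve 2 (λ w J → J :+ w :* J := (con 1 :+ w) :* J) ≈-refl (weight e) (joinSum Vs L T) ⟩
        (1# + weight e) * joinSum Vs L T
      ∎

    joinSum-loops : ∀ {w} Vs L M T → All (λ e → weight e ≡ w) L →
                    joinSum Vs (L ++ M) T
                      ≈ pow R (1# + w) (length (filter loop? L)) * joinSum Vs (filter (¬? ∘ loop?) L ++ M) T
    joinSum-loops Vs []      M T []          = ≈-sym (*-identityˡ _)
    joinSum-loops Vs (e ∷ L) M T (refl ∷ ws) with loop? e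
    ... | yes t≡s =
      begin
        joinSum Vs (e ∷ L ++ M) T
      ≈⟨ joinSum-loop Vs e (L ++ M) T t≡s ⟩
        (1# + weight e) * joinSum Vs (L ++ M) T
      ≈⟨ *-congˡ (joinSum-loops Vs L M T ws) ⟩
        (1# + weight e) * (pow R (1# + weight e) k * joinSum Vs (L′ ++ M) T)
      ≈⟨ *-assoc _ _ _ ⟨
        pow R (1# + weight e) (suc k) * joinSum Vs (L′ ++ M) T
      ∎
      where
        k = length (filter loop? L)
        L′ = filter (¬? ∘ loop?) L
    ... | no _ =
      begin
        joinSum Vs (L ++ M) T + weight e * joinSum Vs (L ++ M) (T +∂ e)
      ≈⟨ +-cong (joinSum-loops Vs L M T ws) (*-congˡ (joinSum-loops Vs L M (T +∂ e) ws)) ⟩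
        p * joinSum Vs (L′ ++ M) T + weight e * (p * joinSum Vs (L′ ++ M) (T +∂ e))
      ≈⟨ solve 4 (λ p w A B → p :* A :+ w :* (p :* B) := p :* (A :+ w :* B))
               ≈-refl p (weight e) (joinSum Vs (L′ ++ M) T) (joinSum Vs (L′ ++ M) (T +∂ e)) ⟩
        p * (joinSum Vs (L′ ++ M) T + weight e * joinSum Vs (L′ ++ M) (T +∂ e))
      ∎
      where
        p = pow R (1# + weight e) (length (filter loop? L))
        L′ = filter (¬? ∘ loop?) L

  module _ {V W : Set} (_≟V_ : DecidableEquality V) (_≟W_ : DecidableEquality W)
           {φ : V → W} (φ-injective : Injective _≡_ _≡_ φ) where
    open Joins

    does-≟-injective : ∀ a b → does (φ a ≟W φ b) ≡ does (a ≟V b)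
    does-≟-injective a b with a ≟V b
    ... | yes refl = dec-true (φ a ≟W φ a) refl
    ... | no a≢b   = dec-false (φ a ≟W φ b) (a≢b ∘ φ-injective)

    joinSum-map : ∀ Vs L T → joinSum _≟W_ (map φ Vs) (map (mapEdge φ) L) T ≈ joinSum _≟V_ Vs L (T ∘ φ)
    joinSum-map Vs []               T rewrite ≡.sym (map-∘ {g = not ∘ T} {f = φ} Vs) = ≈-refl
    joinSum-map Vs (edge s t w ∷ L) T =
      +-cong (joinSum-map Vs L T)
             (*-congˡ (≈-trans (joinSum-map Vs L _) (joinSum-congᵗ _≟V_ Vs L (λ v →
                cong₂ (λ a b → T (φ v) xor (a xor b)) (does-≟-injective v s) (does-≟-injective v t)))))

act-injective : ∀ {n} s → Injective _≡_ _≡_ (act {n} s)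
act-injective s  {[]}        {[]}        _  = refl
act-injective ga {false ∷ u} {false ∷ v} eq = cong (false ∷_) (act-injective gb (cong tail eq))
act-injective ga {true ∷ u}  {true ∷ v}  eq = eq
act-injective gb {false ∷ u} {false ∷ v} eq = cong (false ∷_) (act-injective ga (cong tail eq))
act-injective gb {true ∷ u}  {true ∷ v}  eq = cong (true ∷_) (cong tail eq)
act-injective ga {false ∷ u} {true ∷ v}  ()
act-injective ga {true ∷ u}  {false ∷ v} ()
act-injective gb {false ∷ u} {true ∷ v}  ()
act-injective gb {true ∷ u}  {false ∷ v} ()

map-act-↭ : ∀ n s → map (act s) (words n) ↭ words n
map-act-↭ zero    s  = ↭-refl
map-act-↭ (suc n) ga = begin
  map (act ga) (map (false ∷_) W ++ map (true ∷_) W)  ≡⟨ map-++ (act ga) (map (false ∷_) W) _ ⟩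
  map (act ga) (map (false ∷_) W) ++ map (act ga) (map (true ∷_) W)
    ≡⟨ cong₂ _++_ (≡.trans (≡.sym (map-∘ W)) (map-∘ W)) (≡.sym (map-∘ W)) ⟩
  map (false ∷_) (map (act gb) W) ++ map (true ∷_) W  ↭⟨ ↭.++⁺ʳ _ (↭.map⁺ (false ∷_) (map-act-↭ n gb)) ⟩
  map (false ∷_) W ++ map (true ∷_) W                 ∎
  where
    W = words n
    open PermutationReasoning
map-act-↭ (suc n) gb = begin
  map (act gb) (map (false ∷_) W ++ map (true ∷_) W)  ≡⟨ map-++ (act gb) (map (false ∷_) W) _ ⟩
  map (act gb) (map (false ∷_) W) ++ map (act gb) (map (true ∷_) W)
    ≡⟨ cong₂ _++_ (≡.trans (≡.sym (map-∘ W)) (map-∘ W)) (≡.sym (map-∘ W)) ⟩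
  map (true ∷_) (map (act ga) W) ++ map (false ∷_) W  ↭⟨ ↭.++⁺ʳ _ (↭.map⁺ (true ∷_) (map-act-↭ n ga)) ⟩
  map (true ∷_) W ++ map (false ∷_) W                 ↭⟨ ↭.++-comm (map (true ∷_) W) _ ⟩
  map (false ∷_) W ++ map (true ∷_) W                 ∎
  where
    W = words n
    open PermutationReasoning

words-unique : ∀ n → Unique (words n)
words-unique zero    = [] ∷ []
words-unique (suc n) =
  Unique.++⁺ (Unique.map⁺ (cong tail) (words-unique n)) (Unique.map⁺ (cong tail) (words-unique n)) disjoint
  where
    disjoint : ∀ {v} → ¬ (v ∈ map (false ∷_) (words n) × v ∈ map (true ∷_) (words n))
    disjoint (v∈₀ , v∈₁) with ∈-map⁻ (false ∷_) v∈₀ | ∈-map⁻ (true ∷_) v∈₁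
    ... | _ , _ , refl | _ , _ , ()

length-words : ∀ n → length (words n) ≡ 2 ^ n
length-words zero    = refl
length-words (suc n) = begin
  length (map (false ∷_) (words n) ++ map (true ∷_) (words n))
    ≡⟨ length-++ (map (false ∷_) (words n)) ⟩
  length (map (false ∷_) (words n)) ℕ.+ length (map (true ∷_) (words n))
    ≡⟨ cong₂ ℕ._+_ (length-map (false ∷_) (words n)) (length-map (true ∷_) (words n)) ⟩
  length (words n) ℕ.+ length (words n)
    ≡⟨ cong (λ k → k ℕ.+ k) (length-words n) ⟩
  2 ^ n ℕ.+ 2 ^ n
    ≡⟨ cong (2 ^ n ℕ.+_) (≡.sym (ℕ.+-identityʳ (2 ^ n))) ⟩
  2 ^ suc n ∎
  where open ≡.≡-Reasoning

Fixed : ∀ {n} → Gen → Vec Bool n → Set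
Fixed s u = act s u ≡ u

fixed? : ∀ {n} s → Decidable (Fixed {n} s)
fixed? s u = act s u ≟W u

moves? : ∀ {n} s → Decidable (λ (u : Vec Bool n) → ¬ Fixed s u)
moves? s u = ¬? (fixed? s u)

Moving : ∀ {n} → Edge n → Set
Moving (s , u) = ¬ Fixed s u

moving? : ∀ {n} → Decidable (Moving {n})
moving? (s , u) = moves? s u

incident? : ∀ {n} (v : Vec Bool n) (e : Edge n) → Dec (v ≡ proj₂ e ⊎ v ≡ act (proj₁ e) (proj₂ e))
incident? v e = (v ≟W proj₂ e) ⊎-dec (v ≟W act (proj₁ e) (proj₂ e))

gb-moves : ∀ {n} (u : Vec Bool (suc n)) → ¬ Fixed gb u
gb-moves (false ∷ _) ()
gb-moves (true ∷ _)  ()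

ga-fixes-1∷ : ∀ {n} (w : Vec Bool n) → Fixed ga (true ∷ w)
ga-fixes-1∷ w = refl

edges-moving : ∀ n → All Moving (edges n)
edges-moving n = Allₚ.all-filter moving? (concatMap (λ s → map (s ,_) (words n)) (ga ∷ gb ∷ []))

edges-by-generator : ∀ n → edges n ≡ map (ga ,_) (filter (moves? ga) (words n))
                                   ++ map (gb ,_) (filter (moves? gb) (words n))
edges-by-generator n = begin
  filter moving? (map (ga ,_) W ++ map (gb ,_) W ++ [])
    ≡⟨ cong (λ L → filter moving? (map (ga ,_) W ++ L)) (++-identityʳ _) ⟩
  filter moving? (map (ga ,_) W ++ map (gb ,_) W)
    ≡⟨ filter-++ moving? (map (ga ,_) W) _ ⟩
  filter moving? (map (ga ,_) W) ++ filter moving? (map (gb ,_) W)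
    ≡⟨ cong₂ _++_ (filter-map-comm moving? (moves? ga) (ga ,_) (λ _ → refl) W)
                  (filter-map-comm moving? (moves? gb) (gb ,_) (λ _ → refl) W) ⟩
  map (ga ,_) (filter (moves? ga) W) ++ map (gb ,_) (filter (moves? gb) W) ∎
  where
    W = words n
    open ≡.≡-Reasoning

moves-ga-suc : ∀ n → filter (moves? ga) (words (suc n)) ≡ map (false ∷_) (filter (moves? gb) (words n))
moves-ga-suc n = begin
  filter (moves? ga) (map (false ∷_) W ++ map (true ∷_) W)
    ≡⟨ filter-++ (moves? ga) (map (false ∷_) W) _ ⟩
  filter (moves? ga) (map (false ∷_) W) ++ filter (moves? ga) (map (true ∷_) W)
    ≡⟨ cong₂ _++_ (filter-map-comm (moves? ga) (moves? gb) (false ∷_) (λ _ → refl) W)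
                  (filter-none (moves? ga) (Allₚ.map⁺ (universal (λ w moves → moves (ga-fixes-1∷ w)) W))) ⟩
  map (false ∷_) (filter (moves? gb) W) ++ []
    ≡⟨ ++-identityʳ _ ⟩
  map (false ∷_) (filter (moves? gb) W) ∎
  where
    W = words n
    open ≡.≡-Reasoning

moves-gb-suc : ∀ n → filter (moves? gb) (words (suc n)) ≡ words (suc n)
moves-gb-suc n = filter-all (moves? gb) (universal gb-moves (words (suc n)))

fixedCount : ℕ → ℕ
fixedCount n = length (filter (fixed? ga) (words n))

fixedCount-suc-suc : ∀ k → fixedCount (suc (suc k)) ≡ 2 ^ suc k
fixedCount-suc-suc k = begin
  length (filter (fixed? ga) (map (false ∷_) W ++ map (true ∷_) W))
    ≡⟨ cong length (filter-++ (fixed? ga) (map (false ∷_) W) _) ⟩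
  length (filter (fixed? ga) (map (false ∷_) W) ++ filter (fixed? ga) (map (true ∷_) W))
    ≡⟨ cong₂ (λ A B → length (A ++ B))
             (filter-none (fixed? ga) (Allₚ.map⁺ (universal (λ w → gb-moves w ∘ cong tail) W)))
             (filter-all (fixed? ga) (Allₚ.map⁺ (universal ga-fixes-1∷ W))) ⟩
  length (map (true ∷_) W)
    ≡⟨ length-map (true ∷_) W ⟩
  length W
    ≡⟨ length-words (suc k) ⟩
  2 ^ suc k ∎
  where
    W = words (suc k)
    open ≡.≡-Reasoning

module ClosedPolygons {c ℓ : Level} (R : CommutativeSemiring c ℓ) where
  open CommutativeSemiring R renaming (refl to ≈-refl; sym to ≈-sym; trans to ≈-trans)
  open EdgeSubsetSums R
  open SetoidReasoning setoid
  open import Algebra.Solver.Ring.NaturalCoefficients.Default R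

  sumR-++ : ∀ as bs → sumR R (as ++ bs) ≈ sumR R as + sumR R bs
  sumR-++ []       bs = ≈-sym (+-identityˡ _)
  sumR-++ (a ∷ as) bs = ≈-trans (+-congˡ (sumR-++ as bs)) (≈-sym (+-assoc _ _ _))

  sumR-cong : {A : Set} {f g : A → Carrier} → (∀ a → f a ≈ g a) →
              ∀ as → sumR R (map f as) ≈ sumR R (map g as)
  sumR-cong f≈g []       = ≈-refl
  sumR-cong f≈g (a ∷ as) = +-cong (f≈g a) (sumR-cong f≈g as)

  sumR-*ˡ : {A : Set} (k : Carrier) (f : A → Carrier) →
            ∀ as → sumR R (map (λ a → k * f a) as) ≈ k * sumR R (map f as)
  sumR-*ˡ k f []       = ≈-sym (zeroʳ k)
  sumR-*ˡ k f (a ∷ as) = ≈-trans (+-congˡ (sumR-*ˡ k f as)) (≈-sym (distribˡ _ _ _))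

  module _ {n : ℕ} (x y : Carrier) where
    open Joins (_≟W_ {n})

    labelWeight : Gen → Carrier
    labelWeight ga = x
    labelWeight gb = y

    weighted : Edge n → WeightedEdge (Vec Bool n)
    weighted (s , u) = edge u (act s u) (labelWeight s)

    -- hasBoundary T X holds when the vertices of odd X-degree are exactly those where T holds.
    hasBoundary : (Vec Bool n → Bool) → List (Edge n) → Bool
    hasBoundary T X = all (λ v → T v xor isEven (degree v X)) (words n)

    polygonWeight : List (Edge n) → Carrier
    polygonWeight X = pow R x (countLabel ga X) * pow R y (countLabel gb X)

    boundarySum : List (Edge n) → (Vec Bool n → Bool) → Carrier
    boundarySum L T = sumR R (map (λ X → if hasBoundary T X then polygonWeight X else 0#) (sublists L))

    isEven-degree-∷ : ∀ (v : Vec Bool n) e X →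
                      isEven (degree v (e ∷ X)) ≡ does (incident? v e) xor isEven (degree v X)
    isEven-degree-∷ v e X with does (incident? v e)
    ... | true  = refl
    ... | false = refl

    incident≡boundary : ∀ v e → Moving e → does (incident? v e) ≡ boundary (weighted e) v
    incident≡boundary v (s , u) moves with v ≟W u | v ≟W act s u
    ... | yes refl | yes su≡u = ⊥-elim (moves (≡.sym su≡u))
    ... | yes _    | no _     = refl
    ... | no _     | yes _    = refl
    ... | no _     | no _     = refl

    hasBoundary-[] : ∀ T → hasBoundary T [] ≡ vanishesOn (words n) T
    hasBoundary-[] T = cong and (map-cong (λ v → ≡.trans (xor-comm (T v) true) (true-xor (T v))) (words n))

    hasBoundary-∷ : ∀ T e X → Moving e → hasBoundary T (e ∷ X) ≡ hasBoundary (T +∂ weighted e) X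
    hasBoundary-∷ T e X moves = cong and (map-cong (λ v →
      ≡.trans (cong (T v xor_) (≡.trans (isEven-degree-∷ v e X) (cong (_xor _) (incident≡boundary v e moves))))
              (≡.sym (xor-assoc (T v) _ _))) (words n))

    polygonWeight-∷ : ∀ e X → polygonWeight (e ∷ X) ≈ weight (weighted e) * polygonWeight X
    polygonWeight-∷ (ga , u) X = *-assoc _ _ _
    polygonWeight-∷ (gb , u) X =
      solve 3 (λ a b c → a :* (b :* c) := b :* (a :* c))
              ≈-refl (pow R x (countLabel ga X)) y (pow R y (countLabel gb X))

    boundarySum≈joinSum : ∀ L T → All Moving L → boundarySum L T ≈ joinSum (words n) (map weighted L) T
    boundarySum≈joinSum [] T [] rewrite hasBoundary-[] T with vanishesOn (words n) T
    ... | true  = ≈-trans (+-identityʳ _) (*-identityˡ 1#)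
    ... | false = +-identityʳ 0#
    boundarySum≈joinSum (e ∷ L) T (moves ∷ moving) =
      begin
        sumR R (map F (sublists L ++ map (e ∷_) (sublists L)))
      ≡⟨ cong (sumR R) (map-++ F (sublists L) _) ⟩
        sumR R (map F (sublists L) ++ map F (map (e ∷_) (sublists L)))
      ≈⟨ sumR-++ (map F (sublists L)) _ ⟩
        boundarySum L T + sumR R (map F (map (e ∷_) (sublists L)))
      ≡⟨ cong (λ Xs → boundarySum L T + sumR R Xs) (≡.sym (map-∘ (sublists L))) ⟩
        boundarySum L T + sumR R (map (F ∘ (e ∷_)) (sublists L))
      ≈⟨ +-congˡ (sumR-cong extend (sublists L)) ⟩
        boundarySum L T + sumR R (map (λ X → w * F′ X) (sublists L))
      ≈⟨ +-cong (boundarySum≈joinSum L T moving)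
                (≈-trans (sumR-*ˡ w F′ (sublists L)) (*-congˡ (boundarySum≈joinSum L T′ moving))) ⟩
        joinSum (words n) (map weighted L) T + w * joinSum (words n) (map weighted L) T′
      ∎
      where
        w = weight (weighted e)
        T′ = T +∂ weighted e
        F F′ : List (Edge n) → Carrier
        F X = if hasBoundary T X then polygonWeight X else 0#
        F′ X = if hasBoundary T′ X then polygonWeight X else 0#
        extend : ∀ X → F (e ∷ X) ≈ w * F′ X
        extend X rewrite hasBoundary-∷ T e X moves with hasBoundary T′ X
        ... | true  = polygonWeight-∷ e X
        ... | false = ≈-sym (zeroʳ w)

    Γcl-as-joinSum : Γcl R n x y ≈ joinSum (words n) (map weighted (edges n)) (λ _ → false)
    Γcl-as-joinSum = boundarySum≈joinSum (edges n) (λ _ → false) (edges-moving n)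

module BasilicaRecursion {c ℓ : Level} (R : CommutativeSemiring c ℓ)
                         (x y : CommutativeSemiring.Carrier R) (n : ℕ) where
  open CommutativeSemiring R renaming (refl to ≈-refl; sym to ≈-sym; trans to ≈-trans)
  open EdgeSubsetSums R
  open ClosedPolygons R
  open Joins (_≟W_ {suc n})

  W : List (Vec Bool n)
  W = words n

  V⁺ : Set
  V⁺ = Vec Bool (suc n)

  none : V⁺ → Bool
  none _ = false

  middle : Vec Bool n → V⁺
  middle w = true ∷ act ga w

  inEdge outEdge merged : Vec Bool n → WeightedEdge V⁺
  inEdge w  = edge (false ∷ w) (middle w) y
  outEdge w = edge (middle w) (false ∷ act ga w) y
  merged w  = edge (false ∷ w) (false ∷ act ga w) (y * y)

  paths : List (Vec Bool n) → List (WeightedEdge V⁺)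
  paths []       = []
  paths (w ∷ ws) = inEdge w ∷ outEdge w ∷ paths ws

  aEdges : List (WeightedEdge V⁺)
  aEdges = map (λ w → edge (false ∷ w) (false ∷ act gb w) x) (filter (moves? gb) W)

  AvoidsOneWords : WeightedEdge V⁺ → Set
  AvoidsOneWords e = ∀ w → boundary e (true ∷ w) ≡ false

  zeroEdge-avoidsOneWords : ∀ u v k → AvoidsOneWords (edge (false ∷ u) (false ∷ v) k)
  zeroEdge-avoidsOneWords u v k w = boundary-∉ {true ∷ w} (edge (false ∷ u) (false ∷ v) k) (λ ()) (λ ())

  paths-avoid : ∀ w ws → All (λ w′ → ¬ w ≡ w′) ws → All (λ e → boundary e (middle w) ≡ false) (paths ws)
  paths-avoid w []        []            = []
  paths-avoid w (w′ ∷ ws) (w≢w′ ∷ w≢ws) =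
    boundary-∉ (inEdge w′) (λ ()) apart ∷ boundary-∉ (outEdge w′) apart (λ ()) ∷ paths-avoid w ws w≢ws
    where
      apart : ¬ middle w ≡ middle w′
      apart = w≢w′ ∘ act-injective ga ∘ cong tail

  smooth-paths : ∀ ws Us L → Unique ws → All AvoidsOneWords L →
                 joinSum (map middle ws ++ Us) (paths ws ++ L) none ≈ joinSum Us (map merged ws ++ L) none
  smooth-paths []       Us L _               avoiding = ≈-refl
  smooth-paths (w ∷ ws) Us L (w∉ws ∷ unique) avoiding =
    begin
      joinSum (middle w ∷ map middle ws ++ Us) (inEdge w ∷ outEdge w ∷ paths ws ++ L) none
    ≈⟨ joinSum-series y y (map middle ws ++ Us) (paths ws ++ L) none (λ ()) (λ ()) middle-isolated refl ⟩
      joinSum (map middle ws ++ Us) (merged w ∷ paths ws ++ L) none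
    ≈⟨ joinSum-↭ _ (↭-sym (↭.shift (merged w) (paths ws) L)) none ⟩
      joinSum (map middle ws ++ Us) (paths ws ++ merged w ∷ L) none
    ≈⟨ smooth-paths ws Us (merged w ∷ L) unique (zeroEdge-avoidsOneWords w (act ga w) (y * y) ∷ avoiding) ⟩
      joinSum Us (map merged ws ++ merged w ∷ L) none
    ≈⟨ joinSum-↭ Us (↭.shift (merged w) (map merged ws) L) none ⟩
      joinSum Us (merged w ∷ map merged ws ++ L) none
    ∎
    where
      open SetoidReasoning setoid
      middle-isolated = Allₚ.++⁺ (paths-avoid w ws w∉ws) (All.map (λ avoids → avoids (act ga w)) avoiding)

  weighted-ga-suc : map (weighted x y) (map (ga ,_) (filter (moves? ga) (words (suc n)))) ≡ aEdges
  weighted-ga-suc rewrite moves-ga-suc n = map-∘₃ (weighted x y) (ga ,_) (false ∷_) (filter (moves? gb) W)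

  weighted-gb-suc : map (weighted x y) (map (gb ,_) (filter (moves? gb) (words (suc n))))
                    ≡ map inEdge W ++ map (λ w → edge (true ∷ w) (false ∷ w) y) W
  weighted-gb-suc = begin
    map (weighted x y) (map (gb ,_) (filter (moves? gb) (words (suc n))))
      ≡⟨ cong (map (weighted x y) ∘ map (gb ,_)) (moves-gb-suc n) ⟩
    map (weighted x y) (map (gb ,_) (map (false ∷_) W ++ map (true ∷_) W))
      ≡⟨ cong (map (weighted x y)) (map-++ (gb ,_) (map (false ∷_) W) _) ⟩
    map (weighted x y) (map (gb ,_) (map (false ∷_) W) ++ map (gb ,_) (map (true ∷_) W))
      ≡⟨ map-++ (weighted x y) (map (gb ,_) (map (false ∷_) W)) _ ⟩
    map (weighted x y) (map (gb ,_) (map (false ∷_) W)) ++ map (weighted x y) (map (gb ,_) (map (true ∷_) W))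
      ≡⟨ cong₂ _++_ (map-∘₃ (weighted x y) (gb ,_) (false ∷_) W)
                    (map-∘₃ (weighted x y) (gb ,_) (true ∷_) W) ⟩
    map inEdge W ++ map (λ w → edge (true ∷ w) (false ∷ w) y) W ∎
    where open ≡.≡-Reasoning

  interleave : ∀ ws → map inEdge ws ++ map outEdge ws ↭ paths ws
  interleave []       = ↭-refl
  interleave (w ∷ ws) =
    prep (inEdge w) (↭-trans (↭.shift (outEdge w) (map inEdge ws) (map outEdge ws))
                             (prep (outEdge w) (interleave ws)))

  weighted-edges-suc : map (weighted x y) (edges (suc n)) ↭ paths W ++ aEdges
  weighted-edges-suc = begin
    map (weighted x y) (edges (suc n))
      ≡⟨ cong (map (weighted x y)) (edges-by-generator (suc n)) ⟩
    map (weighted x y) (map (ga ,_) (filter (moves? ga) (words (suc n)))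
                        ++ map (gb ,_) (filter (moves? gb) (words (suc n))))
      ≡⟨ map-++ (weighted x y) (map (ga ,_) (filter (moves? ga) (words (suc n)))) _ ⟩
    map (weighted x y) (map (ga ,_) (filter (moves? ga) (words (suc n))))
      ++ map (weighted x y) (map (gb ,_) (filter (moves? gb) (words (suc n))))
      ≡⟨ cong₂ _++_ weighted-ga-suc weighted-gb-suc ⟩
    aEdges ++ map inEdge W ++ map (λ w → edge (true ∷ w) (false ∷ w) y) W
      ↭⟨ ↭.++⁺ˡ aEdges (↭.++⁺ˡ (map inEdge W) downward) ⟩
    aEdges ++ map inEdge W ++ map outEdge W
      ↭⟨ ↭.++⁺ˡ aEdges (interleave W) ⟩
    aEdges ++ paths W
      ↭⟨ ↭.++-comm aEdges (paths W) ⟩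
    paths W ++ aEdges ∎
    where
      open PermutationReasoning
      downward : map (λ w → edge (true ∷ w) (false ∷ w) y) W ↭ map outEdge W
      downward = ↭-sym (≡.subst (_↭ map (λ w → edge (true ∷ w) (false ∷ w) y) W) (≡.sym (map-∘ W))
                                (↭.map⁺ (λ w → edge (true ∷ w) (false ∷ w) y) (map-act-↭ n ga)))

  words-suc-↭ : words (suc n) ↭ map middle W ++ map (false ∷_) W
  words-suc-↭ = begin
    map (false ∷_) W ++ map (true ∷_) W
      ↭⟨ ↭.++-comm (map (false ∷_) W) _ ⟩
    map (true ∷_) W ++ map (false ∷_) W
      ↭⟨ ↭.++⁺ʳ _ (↭.map⁺ (true ∷_) (↭-sym (map-act-↭ n ga))) ⟩
    map (true ∷_) (map (act ga) W) ++ map (false ∷_) W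
      ≡⟨ cong (_++ map (false ∷_) W) (≡.sym (map-∘ W)) ⟩
    map middle W ++ map (false ∷_) W ∎
    where open PermutationReasoning

  loop-count : length (filter loop? (map merged W)) ≡ fixedCount n
  loop-count = ≡.trans (cong length (filter-map-comm loop? (fixed? ga) merged (λ _ → refl) W))
                       (length-map merged (filter (fixed? ga) W))

  lowered-edges : filter (¬? ∘ loop?) (map merged W) ++ aEdges
                  ≡ map (mapEdge (false ∷_)) (map (weighted (y * y) x) (edges n))
  lowered-edges = ≡.sym (begin
    map (mapEdge (false ∷_)) (map (weighted (y * y) x) (edges n))
      ≡⟨ cong (map (mapEdge (false ∷_)) ∘ map (weighted (y * y) x)) (edges-by-generator n) ⟩
    map (mapEdge (false ∷_)) (map (weighted (y * y) x) (map (ga ,_) As ++ map (gb ,_) Bs))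
      ≡⟨ cong (map (mapEdge (false ∷_))) (map-++ (weighted (y * y) x) (map (ga ,_) As) _) ⟩
    map (mapEdge (false ∷_)) (map (weighted (y * y) x) (map (ga ,_) As) ++ map (weighted (y * y) x) (map (gb ,_) Bs))
      ≡⟨ map-++ (mapEdge (false ∷_)) (map (weighted (y * y) x) (map (ga ,_) As)) _ ⟩
    map (mapEdge (false ∷_)) (map (weighted (y * y) x) (map (ga ,_) As))
      ++ map (mapEdge (false ∷_)) (map (weighted (y * y) x) (map (gb ,_) Bs))
      ≡⟨ cong₂ _++_ (≡.trans (map-∘₃ (mapEdge (false ∷_)) (weighted (y * y) x) (ga ,_) As)
                             (≡.sym (filter-map-comm (¬? ∘ loop?) (moves? ga) merged (λ _ → refl) W)))
                    (map-∘₃ (mapEdge (false ∷_)) (weighted (y * y) x) (gb ,_) Bs) ⟩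
    filter (¬? ∘ loop?) (map merged W) ++ aEdges ∎)
    where
      As = filter (moves? ga) W
      Bs = filter (moves? gb) W
      open ≡.≡-Reasoning

  Γcl-suc : Γcl R (suc n) x y ≈ pow R (1# + y * y) (fixedCount n) * Γcl R n (y * y) x
  Γcl-suc = begin
    Γcl R (suc n) x y
      ≈⟨ Γcl-as-joinSum {suc n} x y ⟩
    joinSum (words (suc n)) (map (weighted x y) (edges (suc n))) none
      ≈⟨ joinSum-↭ (words (suc n)) weighted-edges-suc none ⟩
    joinSum (words (suc n)) (paths W ++ aEdges) none
      ≈⟨ joinSum-↭ᵛ words-suc-↭ (paths W ++ aEdges) none ⟩
    joinSum (map middle W ++ W₀) (paths W ++ aEdges) none
      ≈⟨ smooth-paths W W₀ aEdges (words-unique n) aEdges-avoid ⟩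
    joinSum W₀ (map merged W ++ aEdges) none
      ≈⟨ joinSum-loops W₀ (map merged W) aEdges none (Allₚ.map⁺ (universal (λ _ → refl) W)) ⟩
    pow R (1# + y * y) (length (filter loop? (map merged W)))
      * joinSum W₀ (filter (¬? ∘ loop?) (map merged W) ++ aEdges) none
      ≡⟨ cong₂ (λ k L → pow R (1# + y * y) k * joinSum W₀ L none) loop-count lowered-edges ⟩
    pow R (1# + y * y) (fixedCount n) * joinSum W₀ (map (mapEdge (false ∷_)) Σ′) none
      ≈⟨ *-congˡ (joinSum-map _≟W_ _≟W_ (cong tail) W Σ′ none) ⟩
    pow R (1# + y * y) (fixedCount n) * Joins.joinSum _≟W_ W Σ′ (λ _ → false)
      ≈⟨ *-congˡ (≈-sym (Γcl-as-joinSum {n} (y * y) x)) ⟩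
    pow R (1# + y * y) (fixedCount n) * Γcl R n (y * y) x ∎
    where
      open SetoidReasoning setoid
      W₀ = map (false ∷_) W
      Σ′ = map (weighted (y * y) x) (edges n)
      aEdges-avoid = Allₚ.map⁺ (universal (λ w → zeroEdge-avoidsOneWords w (act gb w) x) (filter (moves? gb) W))

module ClosedForms {c ℓ : Level} (R : CommutativeSemiring c ℓ) where
  open CommutativeSemiring R renaming (refl to ≈-refl; sym to ≈-sym; trans to ≈-trans)
  open SetoidReasoning setoid
  open import Algebra.Solver.Ring.NaturalCoefficients.Default R
  module Exp = Algebra.Properties.Semiring.Exp semiring

  pow≡^ : ∀ a k → pow R a k ≡ a Exp.^ k
  pow≡^ a zero    = refl
  pow≡^ a (suc k) = cong (a *_) (pow≡^ a k)

  pow-cong : ∀ {a b} k {l} → a ≈ b → k ≡ l → pow R a k ≈ pow R b l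
  pow-cong {a} {b} k a≈b refl rewrite pow≡^ a k | pow≡^ b k = Exp.^-congˡ k a≈b

  pow-square : ∀ a k → pow R (a * a) (2 ^ k) ≈ pow R a (2 ^ suc k)
  pow-square a k rewrite pow≡^ (a * a) (2 ^ k) | pow≡^ a (2 ^ suc k) =
    ≈-trans (Exp.^-congˡ (2 ^ k) (*-congˡ (≈-sym (*-identityʳ a)))) (Exp.^-assocʳ a 2 (2 ^ k))

  one-plus-square : ∀ a k → 1# + pow R a (2 ^ suc k) ≈ 1# + pow R (a * a) (2 ^ k)
  one-plus-square a k = +-congˡ (≈-sym (pow-square a k))

  one-plus-pow-2 : ∀ a → 1# + pow R a 2 ≈ 1# + a * a
  one-plus-pow-2 a = +-congˡ (*-congˡ (*-identityʳ a))

  prodTo-cong : ∀ j {F G : ℕ → Carrier} → (∀ k → F k ≈ G k) → prodTo R j F ≈ prodTo R j G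
  prodTo-cong zero    F≈G = ≈-refl
  prodTo-cong (suc j) F≈G = *-cong (prodTo-cong j F≈G) (F≈G (suc j))

  prodTo-suc : ∀ j (F : ℕ → Carrier) → prodTo R (suc j) F ≈ F 1 * prodTo R j (F ∘ suc)
  prodTo-suc zero    F = *-comm 1# (F 1)
  prodTo-suc (suc j) F = ≈-trans (*-congʳ (prodTo-suc j F)) (*-assoc _ _ _)

  xFactors yFactors : ℕ → ℕ → Carrier → Carrier
  xFactors n j x = prodTo R j (λ k → pow R (1# + pow R x (2 ^ k)) (2 ^ (n ∸ 2 ℕ.* k ∸ 1)))
  yFactors n j y = prodTo R j (λ k → pow R (1# + pow R y (2 ^ k)) (2 ^ (n ∸ 2 ℕ.* k)))

  xFactors-step : ∀ n j x →
                  xFactors (suc (suc n)) (suc j) x ≈ pow R (1# + x * x) (2 ^ (n ∸ 1)) * xFactors n j (x * x)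
  xFactors-step n j x =
    ≈-trans (prodTo-suc j _)
            (*-cong (pow-cong (2 ^ (n ∸ 1)) (one-plus-pow-2 x) refl)
                    (prodTo-cong j (λ k → pow-cong _ (one-plus-square x k)
                                            (cong (λ e → 2 ^ (suc (suc n) ∸ e ∸ 1)) (ℕ.*-suc 2 k)))))

  yFactors-step : ∀ n j y →
                  yFactors (suc (suc n)) (suc j) y ≈ pow R (1# + y * y) (2 ^ n) * yFactors n j (y * y)
  yFactors-step n j y =
    ≈-trans (prodTo-suc j _)
            (*-cong (pow-cong (2 ^ n) (one-plus-pow-2 y) refl)
                    (prodTo-cong j (λ k → pow-cong _ (one-plus-square y k)
                                            (cong (λ e → 2 ^ (suc (suc n) ∸ e)) (ℕ.*-suc 2 k)))))

  rhsEven-step : ∀ n j x y →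
    rhsEven R (suc (suc n)) (suc (suc j)) x y
      ≈ pow R (1# + y * y) (2 ^ n) * (pow R (1# + x * x) (2 ^ (n ∸ 1)) * rhsEven R n (suc j) (x * x) (y * y))
  rhsEven-step n j x y =
    begin
      xFactors (suc (suc n)) (suc j) x * yFactors (suc (suc n)) (suc j) y
        * (1# + pow R x (2 ^ suc (suc j))) * pow R (1# + pow R y (2 ^ suc (suc j))) 2
    ≈⟨ *-cong (*-cong (*-cong (xFactors-step n j x) (yFactors-step n j y)) (one-plus-square x (suc j)))
              (pow-cong 2 (one-plus-square y (suc j)) refl) ⟩
      (A * X) * (B * Y) * Sx * Sy
    ≈⟨ solve 6 (λ A X B Y Sx Sy → (A :* X) :* (B :* Y) :* Sx :* Sy := B :* (A :* (X :* Y :* Sx :* Sy)))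
             ≈-refl A X B Y Sx Sy ⟩
      B * (A * (X * Y * Sx * Sy))
    ∎
    where
      A = pow R (1# + x * x) (2 ^ (n ∸ 1))
      B = pow R (1# + y * y) (2 ^ n)
      X = xFactors n j (x * x)
      Y = yFactors n j (y * y)
      Sx = 1# + pow R (x * x) (2 ^ suc j)
      Sy = pow R (1# + pow R (y * y) (2 ^ suc j)) 2

  rhsOdd-step : ∀ n j x y →
    rhsOdd R (suc (suc n)) (suc (suc j)) x y
      ≈ pow R (1# + y * y) (2 ^ n) * (pow R (1# + x * x) (2 ^ (n ∸ 1)) * rhsOdd R n (suc j) (x * x) (y * y))
  rhsOdd-step n j x y =
    begin
      xFactors (suc (suc n)) (suc j) x * yFactors (suc (suc n)) (suc j) y
        * pow R (1# + pow R x (2 ^ suc (suc j))) 2 * pow R (1# + pow R y (2 ^ suc (suc j))) 2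
        * (1# + pow R y (2 ^ suc (suc (suc j))))
    ≈⟨ *-cong (*-cong (*-cong (*-cong (xFactors-step n j x) (yFactors-step n j y))
                              (pow-cong 2 (one-plus-square x (suc j)) refl))
                      (pow-cong 2 (one-plus-square y (suc j)) refl))
              (one-plus-square y (suc (suc j))) ⟩
      (A * X) * (B * Y) * Sx * Sy * Ty
    ≈⟨ solve 7 (λ A X B Y Sx Sy Ty → (A :* X) :* (B :* Y) :* Sx :* Sy :* Ty
                                    := B :* (A :* (X :* Y :* Sx :* Sy :* Ty)))
             ≈-refl A X B Y Sx Sy Ty ⟩
      B * (A * (X * Y * Sx * Sy * Ty))
    ∎
    where
      A = pow R (1# + x * x) (2 ^ (n ∸ 1))
      B = pow R (1# + y * y) (2 ^ n)
      X = xFactors n j (x * x)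
      Y = yFactors n j (y * y)
      Sx = pow R (1# + pow R (x * x) (2 ^ suc j)) 2
      Sy = pow R (1# + pow R (y * y) (2 ^ suc j)) 2
      Ty = 1# + pow R (y * y) (2 ^ suc (suc j))

  Γcl-step : ∀ k x y →
    Γcl R (suc (suc (suc (suc k)))) x y
      ≈ pow R (1# + y * y) (2 ^ suc (suc k)) * (pow R (1# + x * x) (2 ^ suc k) * Γcl R (suc (suc k)) (x * x) (y * y))
  Γcl-step k x y =
    begin
      Γcl R (suc (suc (suc (suc k)))) x y
    ≈⟨ BasilicaRecursion.Γcl-suc R x y (suc (suc (suc k))) ⟩
      pow R (1# + y * y) (fixedCount (suc (suc (suc k)))) * Γcl R (suc (suc (suc k))) (y * y) x
    ≈⟨ *-cong (pow-cong _ ≈-refl (fixedCount-suc-suc (suc k)))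
              (BasilicaRecursion.Γcl-suc R (y * y) x (suc (suc k))) ⟩
      pow R (1# + y * y) (2 ^ suc (suc k))
        * (pow R (1# + x * x) (fixedCount (suc (suc k))) * Γcl R (suc (suc k)) (x * x) (y * y))
    ≈⟨ *-congˡ (*-congʳ (pow-cong _ ≈-refl (fixedCount-suc-suc k))) ⟩
      pow R (1# + y * y) (2 ^ suc (suc k)) * (pow R (1# + x * x) (2 ^ suc k) * Γcl R (suc (suc k)) (x * x) (y * y))
    ∎

  Γcl-2 : ∀ x y → Γcl R 2 x y ≈ rhsEven R 2 1 x y
  Γcl-2 x y =
    begin
      Γcl R 2 x y
    ≈⟨ BasilicaRecursion.Γcl-suc R x y 1 ⟩
      pow R (1# + y * y) 2 * Γcl R 1 (y * y) x
    ≈⟨ *-congˡ (BasilicaRecursion.Γcl-suc R (y * y) x 0) ⟩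
      pow R (1# + y * y) 2 * (pow R (1# + x * x) 1 * (1# * 1# + 0#))
    ≈⟨ solve 2 (λ A B → B :* (A :* con 1 :* (con 1 :* con 1 :+ con 0)) := con 1 :* con 1 :* A :* B)
             ≈-refl (1# + x * x) (pow R (1# + y * y) 2) ⟩
      1# * 1# * (1# + x * x) * pow R (1# + y * y) 2
    ≈⟨ *-cong (*-congˡ (≈-sym (one-plus-pow-2 x))) (pow-cong 2 (≈-sym (one-plus-pow-2 y)) refl) ⟩
      rhsEven R 2 1 x y
    ∎

  Γcl-3 : ∀ x y → Γcl R 3 x y ≈ rhsOdd R 3 1 x y
  Γcl-3 x y =
    begin
      Γcl R 3 x y
    ≈⟨ BasilicaRecursion.Γcl-suc R x y 2 ⟩
      pow R (1# + y * y) 2 * Γcl R 2 (y * y) x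
    ≈⟨ *-congˡ (Γcl-2 (y * y) x) ⟩
      P * (1# * 1# * Q * X)
    ≈⟨ solve 3 (λ P Q X → P :* (con 1 :* con 1 :* Q :* X) := con 1 :* con 1 :* X :* P :* Q) ≈-refl P Q X ⟩
      1# * 1# * X * P * Q
    ≈⟨ *-cong (*-congˡ (pow-cong 2 (≈-sym (one-plus-pow-2 y)) refl)) (≈-sym (one-plus-square y 1)) ⟩
      rhsOdd R 3 1 x y
    ∎
    where
      P = pow R (1# + y * y) 2
      Q = 1# + pow R (y * y) 2
      X = pow R (1# + pow R x 2) 2

  Γcl-even : ∀ m x y → Γcl R (2 ℕ.+ 2 ℕ.* m) x y ≈ rhsEven R (2 ℕ.+ 2 ℕ.* m) (suc m) x y
  Γcl-even zero    x y = Γcl-2 x y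
  Γcl-even (suc m) x y =
    ≡.subst (λ n → Γcl R n x y ≈ rhsEven R n (suc (suc m)) x y)
            (cong (2 ℕ.+_) (≡.sym (ℕ.*-suc 2 m)))
      (≈-trans (Γcl-step (2 ℕ.* m) x y)
               (≈-trans (*-congˡ (*-congˡ (Γcl-even m (x * x) (y * y))))
                        (≈-sym (rhsEven-step (2 ℕ.+ 2 ℕ.* m) m x y))))

  Γcl-odd : ∀ m x y → Γcl R (2 ℕ.+ 2 ℕ.* m ℕ.+ 1) x y ≈ rhsOdd R (2 ℕ.+ 2 ℕ.* m ℕ.+ 1) (suc m) x y
  Γcl-odd zero    x y = Γcl-3 x y
  Γcl-odd (suc m) x y =
    ≡.subst (λ n → Γcl R n x y ≈ rhsOdd R n (suc (suc m)) x y)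
            (cong (λ k → 2 ℕ.+ k ℕ.+ 1) (≡.sym (ℕ.*-suc 2 m)))
      (≈-trans (Γcl-step (2 ℕ.* m ℕ.+ 1) x y)
               (≈-trans (*-congˡ (*-congˡ (Γcl-odd m (x * x) (y * y))))
                        (≈-sym (rhsOdd-step (2 ℕ.+ 2 ℕ.* m ℕ.+ 1) m x y))))

open import Data.Nat using (_+_; _*_; _≤_; s≤s)

mainTheorem12 : {c ℓ : Level} (R : CommutativeSemiring c ℓ) →
    (x y : CommutativeSemiring.Carrier R) →
    ((n m : ℕ) → n ≡ 2 * m + 1 → 5 ≤ n → EqR R (Γcl R n x y) (rhsOdd R n m x y))
    × ((n m : ℕ) → n ≡ 2 * m → 4 ≤ n → EqR R (Γcl R n x y) (rhsEven R n m x y))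
mainTheorem12 R x y = odd , even
  where
    open ClosedForms R
    odd : (n m : ℕ) → n ≡ 2 * m + 1 → 5 ≤ n → EqR R (Γcl R n x y) (rhsOdd R n m x y)
    odd .1               zero    refl (s≤s ())
    odd .(2 * suc m + 1) (suc m) refl _ =
      ≡.subst (λ n → EqR R (Γcl R n x y) (rhsOdd R n (suc m) x y)) (cong (_+ 1) (≡.sym (ℕ.*-suc 2 m)))
              (Γcl-odd m x y)
    even : (n m : ℕ) → n ≡ 2 * m → 4 ≤ n → EqR R (Γcl R n x y) (rhsEven R n m x y)
    even .0           zero    refl ()
    even .(2 * suc m) (suc m) refl _ =
      ≡.subst (λ n → EqR R (Γcl R n x y) (rhsEven R n (suc m) x y)) (≡.sym (ℕ.*-suc 2 m)) (Γcl-even m x y)
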